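{- For every integer $k \geq 1$, the graph $G_k$ is strongly chordal.
   Context: For an integer $k \geq 1$, $G_k := K_k \vee P_{2k+1}$ is the join of a complete graph on vertices $x_1, \ldots, x_k$ with a path on $2k+1$ vertices whose vertices, in order along the path, are $u_1, u_2, \ldots, u_k, z, v_k, v_{k-1}, \ldots, v_1$. (The join $G \vee H$ of disjoint graphs has vertex set $V(G)\cup V(H)$ and edge set $E(G)\cup E(H)\cup\{uv : u \in V(G), v \in V(H)\}$.) A graph is chordal if it has no induced cycle of length at least $4$. A graph is strongly chordal if it is chordal and every even cycle of length at least $6$ has a chord joining two vertices that are at odd distance from each other along the cycle. -}

module Defs where

open import Level using (0ℓ)
open import Data.Nat using (ℕ; zero; suc; _+_; _*_; _∸_; _≤_; _<_)
open import Data.Fin using (Fin; toℕ)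
open import Data.Sum using (_⊎_; inj₁; inj₂)
open import Data.Product using (_×_; Σ; ∃; ∃-syntax; _,_)
open import Data.Unit using (⊤)
open import Relation.Nullary using (¬_)
open import Relation.Binary.PropositionalEquality using (_≡_)
open import Function.Definitions using (Injective)

record Graph : Set₁ where
  field
    Vtx : Set
    Adj : Vtx → Vtx → Set
open Graph public

K : ℕ → Graph
Vtx (K n) = Fin n
Adj (K n) a b = ¬ (a ≡ b)

P : ℕ → Graph
Vtx (P n) = Fin n
Adj (P n) i j = (toℕ j ≡ suc (toℕ i)) ⊎ (toℕ i ≡ suc (toℕ j))

_∨ᴳ_ : Graph → Graph → Graph
Vtx (G ∨ᴳ H) = Vtx G ⊎ Vtx H
Adj (G ∨ᴳ H) (inj₁ a) (inj₁ b) = Adj G a b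
Adj (G ∨ᴳ H) (inj₁ a) (inj₂ b) = ⊤
Adj (G ∨ᴳ H) (inj₂ a) (inj₁ b) = ⊤
Adj (G ∨ᴳ H) (inj₂ a) (inj₂ b) = Adj H a b

-- G_k = K_k ∨ P_{2k+1}; path position i (0-based) is u_{i+1} for i < k,
-- z for i = k, and v_{2k+1-i} for i > k.
Gk : ℕ → Graph
Gk k = K k ∨ᴳ P (suc (2 * k))

CycNext : (n : ℕ) → Fin n → Fin n → Set
CycNext n i j = (toℕ j ≡ suc (toℕ i)) ⊎ ((suc (toℕ i) ≡ n) × (toℕ j ≡ 0))

Consecutive : (n : ℕ) → Fin n → Fin n → Set
Consecutive n i j = CycNext n i j ⊎ CycNext n j i

IsCycle : (G : Graph) (n : ℕ) → (Fin n → Vtx G) → Set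
IsCycle G n c = (3 ≤ n) × Injective _≡_ _≡_ c
              × (∀ i j → CycNext n i j → Adj G (c i) (c j))

IsInducedCycle : (G : Graph) (n : ℕ) → (Fin n → Vtx G) → Set
IsInducedCycle G n c = IsCycle G n c
                     × (∀ i j → Adj G (c i) (c j) → Consecutive n i j)

Chordal : Graph → Set
Chordal G = ∀ (n : ℕ) (c : Fin n → Vtx G) → 4 ≤ n → ¬ IsInducedCycle G n c

Even : ℕ → Set
Even n = ∃[ m ] n ≡ m + m

Odd : ℕ → Set
Odd n = ∃[ m ] n ≡ suc (m + m)

OddChord : (G : Graph) (n : ℕ) → (Fin n → Vtx G) → Set
OddChord G n c = ∃[ i ] ∃[ j ] (toℕ i < toℕ j) × Odd (toℕ j ∸ toℕ i)
                 × ¬ Consecutive n i j × Adj G (c i) (c j)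

StronglyChordal : Graph → Set
StronglyChordal G = Chordal G
  × (∀ (n : ℕ) (c : Fin n → Vtx G) → 6 ≤ n → Even n → IsCycle G n c → OddChord G n c)

-- Every cycle of K_k ∨ P_{2k+1} passes through a vertex x of K_k, since the path
-- part alone is acyclic, and x is adjacent to every other vertex. So on a cycle
-- of length n the vertex x and the vertex d steps away along the cycle (for any
-- d with 2d ≤ n) are joined by a chord: with d = 2 and n ≥ 4 this chord
-- forbids induced cycles, and with d = 3 and n ≥ 6 it is an odd chord.
module Submission where

open import Defs
open import Data.Nat using (ℕ; zero; suc; _+_; _∸_; _≤_; _<_; s≤s; z<s; _≤?_; _<?_)
open import Data.Nat.Properties
open import Data.Fin using (Fin; toℕ; fromℕ<; fromℕ; inject₁)
open import Data.Fin.Properties using (toℕ-injective; toℕ<n; toℕ-fromℕ<; toℕ-fromℕ; toℕ-inject₁)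
open import Data.Sum using (_⊎_; inj₁; inj₂)
open import Data.Product using (_×_; ∃; ∃-syntax; _,_; proj₁; proj₂)
open import Data.Unit using (tt)
open import Data.Empty using (⊥; ⊥-elim)
open import Relation.Nullary using (¬_; yes; no)
open import Relation.Binary.PropositionalEquality
open import Function using (_∘_)
open import Function.Definitions using (Injective)

argmax : ∀ {n} (f : Fin (suc n) → ℕ) → ∃[ i ] (∀ j → f j ≤ f i)
argmax {zero} f = Fin.zero , λ { Fin.zero → ≤-refl }
argmax {suc n} f with argmax (λ j → f (Fin.suc j))
... | i , max with f Fin.zero ≤? f (Fin.suc i)
... | yes f0≤ = Fin.suc i , λ { Fin.zero → f0≤ ; (Fin.suc j) → max j }
... | no f0≰ =
  Fin.zero , λ { Fin.zero → ≤-refl ; (Fin.suc j) → ≤-trans (max j) (<⇒≤ (≰⇒> f0≰)) }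

cycNext-exists : ∀ {n} (i : Fin n) → ∃[ j ] CycNext n i j
cycNext-exists {suc n} i with suc (toℕ i) <? suc n
... | yes i+1<n = fromℕ< i+1<n , inj₁ (toℕ-fromℕ< i+1<n)
... | no i+1≮n = Fin.zero , inj₂ (≤-antisym (toℕ<n i) (≮⇒≥ i+1≮n) , refl)

cycPrev-exists : ∀ {n} (i : Fin n) → ∃[ j ] CycNext n j i
cycPrev-exists {suc n} Fin.zero = fromℕ n , inj₂ (cong suc (toℕ-fromℕ n) , refl)
cycPrev-exists {suc n} (Fin.suc i) = inject₁ i , inj₁ (cong suc (sym (toℕ-inject₁ i)))

cycNext-asym : ∀ {n} {i j : Fin n} → 3 ≤ n → CycNext n i j → ¬ CycNext n j i
cycNext-asym {i = i} _ (inj₁ j≡i+1) (inj₁ i≡j+1) =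
  <⇒≢ (m<n⇒m<1+n (n<1+n (toℕ i))) (trans i≡j+1 (cong suc j≡i+1))
cycNext-asym 3≤n (inj₁ j≡i+1) (inj₂ (j+1≡n , i≡0)) =
  3≰2 (subst (3 ≤_) (trans (sym j+1≡n) (cong suc (trans j≡i+1 (cong suc i≡0)))) 3≤n)
  where 3≰2 : ¬ 3 ≤ 2
        3≰2 (s≤s (s≤s ()))
cycNext-asym 3≤n (inj₂ (i+1≡n , j≡0)) (inj₁ i≡j+1) =
  cycNext-asym 3≤n (inj₁ i≡j+1) (inj₂ (i+1≡n , j≡0))
cycNext-asym 3≤n (inj₂ (i+1≡n , j≡0)) (inj₂ (_ , i≡0)) =
  3≰1 (subst (3 ≤_) (trans (sym i+1≡n) (cong suc i≡0)) 3≤n)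
  where 3≰1 : ¬ 3 ≤ 1
        3≰1 (s≤s ())

-- At a maximum of f both cycle neighbours lie one below it, so injectivity
-- makes them the same position, which is impossible on a cycle of length ≥ 3.
no-unit-step-cycle : ∀ {n} (f : Fin n → ℕ) → 3 ≤ n → Injective _≡_ _≡_ f →
  (∀ i j → CycNext n i j → f j ≡ suc (f i) ⊎ f i ≡ suc (f j)) → ⊥
no-unit-step-cycle {suc n} f 3≤n f-inj step
  with argmax f
... | i , max with cycPrev-exists i | cycNext-exists i
... | p , p→i | q , i→q with step p i p→i | step i q i→q
... | inj₂ fp≡fi+1 | _ = 1+n≰n (subst (_≤ f i) fp≡fi+1 (max p))
... | inj₁ _ | inj₁ fq≡fi+1 = 1+n≰n (subst (_≤ f i) fq≡fi+1 (max q))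
... | inj₁ fi≡fp+1 | inj₂ fi≡fq+1 with f-inj (suc-injective (trans (sym fi≡fp+1) fi≡fq+1))
... | refl = cycNext-asym 3≤n i→q p→i

Acyclic : Graph → Set
Acyclic G = ∀ n (c : Fin n → Vtx G) → ¬ IsCycle G n c

P-acyclic : ∀ m → Acyclic (P m)
P-acyclic m n c (3≤n , c-inj , adj) =
  no-unit-step-cycle (toℕ ∘ c) 3≤n (c-inj ∘ toℕ-injective) adj

inj₁-somewhere-or-inj₂-everywhere : ∀ {n} {A B : Set} (c : Fin n → A ⊎ B) →
  (∃[ i ] ∃[ a ] c i ≡ inj₁ a) ⊎ (∃ λ (d : Fin n → B) → ∀ i → c i ≡ inj₂ (d i))
inj₁-somewhere-or-inj₂-everywhere {zero} c = inj₂ ((λ ()) , λ ())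
inj₁-somewhere-or-inj₂-everywhere {suc n} c
  with c Fin.zero in c0≡ | inj₁-somewhere-or-inj₂-everywhere (c ∘ Fin.suc)
... | inj₁ a | _ = inj₁ (Fin.zero , a , c0≡)
... | inj₂ _ | inj₁ (i , a , ci≡) = inj₁ (Fin.suc i , a , ci≡)
... | inj₂ b | inj₂ (d , c∘suc≡) =
  inj₂ ( (λ { Fin.zero → b ; (Fin.suc i) → d i })
       , λ { Fin.zero → c0≡ ; (Fin.suc i) → c∘suc≡ i })

join-cycle-meets-left : ∀ G {H} → Acyclic H → ∀ {n} {c : Fin n → Vtx (G ∨ᴳ H)} →
  IsCycle (G ∨ᴳ H) n c → ∃[ i ] ∃[ x ] c i ≡ inj₁ x
join-cycle-meets-left G {H} H-acyclic {n} {c} (3≤n , c-inj , adj)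
  with inj₁-somewhere-or-inj₂-everywhere c
... | inj₁ found = found
... | inj₂ (d , c≡d) = ⊥-elim (H-acyclic n d (3≤n , d-inj , d-adj))
  where
  d-inj : Injective _≡_ _≡_ d
  d-inj {i} {j} di≡dj = c-inj (trans (c≡d i) (trans (cong inj₂ di≡dj) (sym (c≡d j))))
  d-adj : ∀ i j → CycNext n i j → Adj H (d i) (d j)
  d-adj i j i→j = subst₂ (Adj (G ∨ᴳ H)) (c≡d i) (c≡d j) (adj i j i→j)

Universal : (G : Graph) → Vtx G → Set
Universal G v = ∀ w → ¬ v ≡ w → Adj G v w × Adj G w v

join-complete-universal : ∀ m H (x : Fin m) → Universal (K m ∨ᴳ H) (inj₁ x)
join-complete-universal m H x (inj₁ y) x≢y = x≢y ∘ cong inj₁ , x≢y ∘ cong inj₁ ∘ sym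
join-complete-universal m H x (inj₂ y) _ = tt , tt

far-apart⇒¬consecutive : ∀ {n e} {a b : Fin n} →
  toℕ b ≡ toℕ a + (2 + e) → 4 + e ≤ n → ¬ Consecutive n a b
far-apart⇒¬consecutive {e = e} {a} b≡ _ (inj₁ (inj₁ b≡a+1)) =
  m+1+n≢m (toℕ a) {e}
    (suc-injective (trans (sym (+-suc (toℕ a) (suc e))) (trans (sym b≡) b≡a+1)))
far-apart⇒¬consecutive {e = e} {a} b≡ _ (inj₁ (inj₂ (_ , b≡0))) =
  1+n≢0 (trans (sym (+-suc (toℕ a) (suc e))) (trans (sym b≡) b≡0))
far-apart⇒¬consecutive {a = a} b≡ _ (inj₂ (inj₁ a≡b+1)) =
  m≢1+m+n (toℕ a) (trans a≡b+1 (cong suc b≡))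
far-apart⇒¬consecutive {n} {e} {a} b≡ 4+e≤n (inj₂ (inj₂ (b+1≡n , a≡0))) =
  1+n≰n (subst (4 + e ≤_) n≡3+e 4+e≤n)
  where
  n≡3+e : n ≡ 3 + e
  n≡3+e = trans (sym b+1≡n) (cong suc (trans b≡ (cong (_+ (2 + e)) a≡0)))

pair-at-distance : ∀ {n} (i : Fin n) d → d + d ≤ n →
  ∃[ a ] ∃[ b ] toℕ b ≡ toℕ a + d × (a ≡ i ⊎ b ≡ i)
pair-at-distance {n} i d d+d≤n with d ≤? toℕ i
... | yes d≤i = fromℕ< i-d<n , i , i≡ , inj₂ refl
  where
  i-d<n : toℕ i ∸ d < n
  i-d<n = ≤-<-trans (m∸n≤m (toℕ i) d) (toℕ<n i)
  i≡ : toℕ i ≡ toℕ (fromℕ< i-d<n) + d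
  i≡ = trans (sym (m∸n+n≡m d≤i)) (cong (_+ d) (sym (toℕ-fromℕ< i-d<n)))
... | no d≰i = i , fromℕ< i+d<n , toℕ-fromℕ< i+d<n , inj₁ refl
  where
  i+d<n : toℕ i + d < n
  i+d<n = ≤-trans (+-monoˡ-< d (≰⇒> d≰i)) d+d≤n

chord-through-universal : ∀ G {n} {c : Fin n → Vtx G} {i} → Injective _≡_ _≡_ c →
  Universal G (c i) → ∀ d → suc d + suc d ≤ n →
  ∃[ a ] ∃[ b ] toℕ b ≡ toℕ a + suc d × Adj G (c a) (c b)
chord-through-universal G {c = c} {i} c-inj univ d 2d+2≤n
  with pair-at-distance i (suc d) 2d+2≤n
... | a , b , b≡ , a≡i⊎b≡i = a , b , b≡ , adjacent a≡i⊎b≡i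
  where
  ca≢cb : c a ≢ c b
  ca≢cb ca≡cb = m+1+n≢m (toℕ a) (sym (trans (cong toℕ (c-inj ca≡cb)) b≡))
  adjacent : a ≡ i ⊎ b ≡ i → Adj G (c a) (c b)
  adjacent (inj₁ refl) = proj₁ (univ (c b) ca≢cb)
  adjacent (inj₂ refl) = proj₂ (univ (c a) (ca≢cb ∘ sym))

cycles-meet-universal⇒stronglyChordal : ∀ G →
  (∀ n (c : Fin n → Vtx G) → IsCycle G n c → ∃[ i ] Universal G (c i)) →
  StronglyChordal G
cycles-meet-universal⇒stronglyChordal G meets = chordal , oddChord
  where
  chordal : Chordal G
  chordal n c 4≤n (cyc@(_ , c-inj , _) , induced) with meets n c cyc
  ... | i , univ with chord-through-universal G c-inj univ 1 4≤n
  ... | a , b , b≡ , ca~cb = far-apart⇒¬consecutive b≡ 4≤n (induced a b ca~cb)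

  oddChord : ∀ n (c : Fin n → Vtx G) → 6 ≤ n → Even n → IsCycle G n c → OddChord G n c
  oddChord n c 6≤n _ cyc@(_ , c-inj , _) with meets n c cyc
  ... | i , univ with chord-through-universal G c-inj univ 2 6≤n
  ... | a , b , b≡ , ca~cb =
    a , b , a<b , (1 , b-a≡3) , far-apart⇒¬consecutive b≡ (≤-trans (n≤1+n 5) 6≤n) , ca~cb
    where
    b-a≡3 : toℕ b ∸ toℕ a ≡ 3
    b-a≡3 = trans (cong (_∸ toℕ a) b≡) (m+n∸m≡n (toℕ a) 3)
    a<b : toℕ a < toℕ b
    a<b = subst (toℕ a <_) (sym b≡) (m<m+n (toℕ a) z<s)

join-complete-cycles-meet-universal : ∀ m {H} → Acyclic H →
  ∀ n (c : Fin n → Vtx (K m ∨ᴳ H)) → IsCycle (K m ∨ᴳ H) n c →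
  ∃[ i ] Universal (K m ∨ᴳ H) (c i)
join-complete-cycles-meet-universal m {H} H-acyclic n c cyc
  with join-cycle-meets-left (K m) H-acyclic cyc
... | i , x , ci≡x =
  i , subst (Universal (K m ∨ᴳ H)) (sym ci≡x) (join-complete-universal m H x)

lemma2p2 : (k : ℕ) → 1 ≤ k → StronglyChordal (Gk k)
lemma2p2 k _ = cycles-meet-universal⇒stronglyChordal (Gk k)
  (join-complete-cycles-meet-universal k (P-acyclic _))
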